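{- Let $k\ge2$, let $A\in L_n^k$, and let $S\subseteq[n]^k$ be such that whenever $a,b\in S$ and $a<b$, we have $f_A(a)=f_A(b)$. Then $|S|\le 3(k-1)n^{k-1}$.
   Context: An order-$n$ $k$-dimensional permutation is an array $A:[n]^{k+1}\to\{0,1\}$ such that every line contains exactly one $1$, where a line is the set of positions obtained by fixing $k$ of the $k+1$ coordinates and letting the remaining coordinate range over $[n]$; $L_n^k$ is the set of these. For $\alpha\in[n]^k$, $f_A(\alpha)$ denotes the unique $t\in[n]$ with $A(\alpha,t)=1$. For $a,b\in[n]^k$, $a<b$ means $a_i<b_i$ for all $1\le i\le k$. -}

module Defs where

open import Data.Nat using (ℕ; suc)
open import Data.Fin using (Fin; fromℕ) renaming (_<_ to _<ᶠ_)
open import Data.Vec using (Vec; insertAt)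
open import Data.Bool using (Bool; true)
open import Data.Product using (Σ; _×_; proj₁)
open import Relation.Binary.PropositionalEquality using (_≡_)
open import Data.Vec.Relation.Binary.Pointwise.Inductive using (Pointwise)

-- [n] is modelled as Fin n; a point of [n]^m is a Vec (Fin n) m.
-- An array A : [n]^(k+1) → {0,1} is a Bool-valued function.
Array : ℕ → ℕ → Set
Array n k = Vec (Fin n) (suc k) → Bool

-- The line obtained by fixing the k coordinates α and letting coordinate i
-- range over [n] is { insertAt α i t | t ∈ [n] }.
-- "Every line contains exactly one 1":
IsPermutation : ∀ {n k} → Array n k → Set
IsPermutation {n} {k} A =
  (i : Fin (suc k)) (α : Vec (Fin n) k) →
  Σ (Fin n) λ t → (A (insertAt α i t) ≡ true) ×
                  ((s : Fin n) → A (insertAt α i s) ≡ true → s ≡ t)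

record Perm (n k : ℕ) : Set where
  field
    arr    : Array n k
    isPerm : IsPermutation arr

open Perm public

-- f_A(α) = the unique t with A(α, t) = 1  (last coordinate varies)
f : ∀ {n k} → Perm n k → Vec (Fin n) k → Fin n
f {k = k} A α = proj₁ (isPerm A (fromℕ k) α)

_≺_ : ∀ {n k} → Vec (Fin n) k → Vec (Fin n) k → Set
a ≺ b = Pointwise _<ᶠ_ a b

-- Write a point of [n]^k as h ∷ β with h ∈ [n] and β ∈ [n]^(k-1), and rank each x ∈ S by the
-- number of points of S below it on its line {t ∷ β}; on a line, a point of S is determined by its
-- rank. If x = h ∷ β has rank ≥ 2 and h ∷ β′ ∈ S with β ≺ β′, then the two points of S below x are
-- both ≺ h ∷ β′, so f_A takes the same value at two distinct points of a line of A, which is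
-- impossible. Two vectors whose coordinates exceed their minima by the same gaps differ by a
-- diagonal translation, hence are equal or comparable; so a point of rank ≥ 2 is determined by h,
-- the position of the minimum of β and the gaps of β. Points of rank 0, of rank 1 and of rank ≥ 2
-- thus each have at most (k-1) n^(k-1) codes.

module Submission where

open import Defs
open import Data.Nat using (ℕ; _≤_; _*_; _∸_; _^_)
open import Data.Fin using (Fin)
open import Data.Vec using (Vec)
open import Data.List using (List; length)
open import Data.List.Membership.Propositional using (_∈_)
open import Data.List.Relation.Unary.Unique.Propositional using (Unique)
open import Relation.Binary.PropositionalEquality using (_≡_)

open import Data.Nat using (zero; suc; z≤n; s≤s; _+_; _<_)
open import Data.Nat.Properties
  using (m∸n≤m; ≤-<-trans; m∸n+n≡m; +-monoʳ-<; ∸-cancelʳ-≡; n∸n≡0; <-cmp; <-irrefl; module ≤-Reasoning)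
open import Data.Fin as Fin using (toℕ; fromℕ; fromℕ<; combine; funToFin; finToFun)
  renaming (_<_ to _<ᶠ_)
open import Data.Fin.Patterns using (0F; 1F; 2F)
open import Data.Fin.Properties
  using (toℕ<n; toℕ-fromℕ<; toℕ-injective; combine-injective; finToFun-funToFin; _≟_; _<?_)
  renaming (<-cmp to <ᶠ-cmp; <-irrefl to <ᶠ-irrefl; <-trans to <ᶠ-trans)
open import Data.Vec using (_∷_; head; tail; lookup; insertAt)
open import Data.Vec.Properties using (tabulate∘lookup; tabulate-cong; ≡-dec)
open import Data.Vec.Functional using (updateAt)
open import Data.Vec.Functional.Properties using (updateAt-updates; updateAt-minimal)
open import Data.Vec.Relation.Binary.Pointwise.Extensional using (ext; extensional⇒inductive)
open import Data.Vec.Relation.Binary.Pointwise.Inductive using (_∷_)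
open import Data.List using ([]; _∷_; map; filter; allFin)
open import Data.List.Properties using (length-map; length-tabulate; length-removeAt′)
open import Data.List.Relation.Unary.Any using (here; there; index; _─_)
open import Data.List.Relation.Unary.All as All using (All; _∷_)
open import Data.List.Relation.Unary.All.Properties using (map⁺)
open import Data.List.Relation.Unary.AllPairs using ([]; _∷_)
open import Data.List.Relation.Unary.Unique.Propositional.Properties using (filter⁺)
open import Data.List.Membership.Propositional.Properties using (∈-filter⁺; ∈-filter⁻; ∈-allFin)
open import Data.List.Relation.Binary.Subset.Propositional using (_⊆_)
open import Data.List.Extrema.Nat using (argmin; f[argmin]≤f[xs])
open import Data.Product using (_×_; _,_; proj₁; proj₂)
open import Data.Sum using (_⊎_; inj₁; inj₂)
open import Data.Bool using (true)
open import Function using (_∘_; id; const)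
open import Relation.Binary using (tri<; tri≈; tri>)
open import Relation.Binary.PropositionalEquality
  using (_≢_; _≗_; refl; sym; trans; cong; subst; module ≡-Reasoning)
open import Relation.Nullary using (Dec; yes; no; contradiction)
open import Relation.Nullary.Decidable using (_×-dec_)

module _ {A : Set} where

  ∈-─ : ∀ {x z : A} {ys} → z ∈ ys → (x∈ys : x ∈ ys) → z ≢ x → z ∈ (ys ─ x∈ys)
  ∈-─ (here refl) (here refl) z≢x = contradiction refl z≢x
  ∈-─ (here refl) (there _)   _   = here refl
  ∈-─ (there z∈ys) (here refl) _  = z∈ys
  ∈-─ (there z∈ys) (there x∈ys) z≢x = there (∈-─ z∈ys x∈ys z≢x)

  Unique⇒length≤ : ∀ {xs ys : List A} → Unique xs → xs ⊆ ys → length xs ≤ length ys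
  Unique⇒length≤ {[]}     _              _     = z≤n
  Unique⇒length≤ {x ∷ xs} {ys} (x∉xs ∷ xs-unique) xs⊆ys = begin
    suc (length xs)          ≤⟨ s≤s (Unique⇒length≤ xs-unique xs⊆ys─x) ⟩
    suc (length (ys ─ x∈ys)) ≡⟨ length-removeAt′ ys (index x∈ys) ⟨
    length ys                ∎
    where
    open ≤-Reasoning
    x∈ys : x ∈ ys
    x∈ys = xs⊆ys (here refl)
    xs⊆ys─x : xs ⊆ (ys ─ x∈ys)
    xs⊆ys─x z∈xs = ∈-─ (xs⊆ys (there z∈xs)) x∈ys (All.lookup x∉xs z∈xs ∘ sym)

  Unique∧allEqual⇒length≤1 : ∀ {xs : List A} → Unique xs →
                             (∀ {x y} → x ∈ xs → y ∈ xs → x ≡ y) → length xs ≤ 1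
  Unique∧allEqual⇒length≤1 {[]}         _                _        = z≤n
  Unique∧allEqual⇒length≤1 {_ ∷ []}     _                _        = s≤s z≤n
  Unique∧allEqual⇒length≤1 {_ ∷ _ ∷ _} ((x≢y ∷ _) ∷ _) allEqual =
    contradiction (allEqual (here refl) (there (here refl))) x≢y

module _ {A B : Set} {g : A → B} where

  Unique-map⁺ : ∀ {xs} → (∀ {x y} → x ∈ xs → y ∈ xs → g x ≡ g y → x ≡ y) →
                Unique xs → Unique (map g xs)
  Unique-map⁺ {[]}     _   []                 = []
  Unique-map⁺ {x ∷ xs} inj (x∉xs ∷ xs-unique) =
    map⁺ (All.tabulate λ y∈xs → All.lookup x∉xs y∈xs ∘ inj (here refl) (there y∈xs))
    ∷ Unique-map⁺ (λ x∈xs y∈xs → inj (there x∈xs) (there y∈xs)) xs-unique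

m∸o≡n∸p∧o<p⇒m<n : ∀ {m n o p} → o ≤ m → p ≤ n → m ∸ o ≡ n ∸ p → o < p → m < n
m∸o≡n∸p∧o<p⇒m<n {m} {n} {o} {p} o≤m p≤n eq o<p = begin-strict
  m          ≡⟨ m∸n+n≡m o≤m ⟨
  m ∸ o + o  <⟨ +-monoʳ-< (m ∸ o) o<p ⟩
  m ∸ o + p  ≡⟨ cong (_+ p) eq ⟩
  n ∸ p + p  ≡⟨ m∸n+n≡m p≤n ⟩
  n          ∎
  where open ≤-Reasoning

lookup-injective : ∀ {A : Set} {j} {xs ys : Vec A j} → lookup xs ≗ lookup ys → xs ≡ ys
lookup-injective {xs = xs} {ys} xs≗ys =
  trans (sym (tabulate∘lookup xs)) (trans (tabulate-cong xs≗ys) (tabulate∘lookup ys))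

module _ {n j : ℕ} (β : Vec (Fin n) (suc j)) where

  -- Opaque because unfolding argmin during unification is prohibitively expensive.
  opaque
    minIndex : Fin (suc j)
    minIndex = argmin (toℕ ∘ lookup β) 0F (allFin (suc j))

    minIndex-minimal : ∀ l → toℕ (lookup β minIndex) ≤ toℕ (lookup β l)
    minIndex-minimal l = All.lookup (f[argmin]≤f[xs] {f = toℕ ∘ lookup β} 0F (allFin (suc j))) (∈-allFin l)

  gap : Fin (suc j) → ℕ
  gap l = toℕ (lookup β l) ∸ toℕ (lookup β minIndex)

  gap<n : ∀ l → gap l < n
  gap<n l = ≤-<-trans (m∸n≤m (toℕ (lookup β l)) (toℕ (lookup β minIndex))) (toℕ<n (lookup β l))

  gap-minIndex : gap minIndex ≡ 0
  gap-minIndex = n∸n≡0 (toℕ (lookup β minIndex))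

  gapFin : Fin (suc j) → Fin n
  gapFin l = fromℕ< (gap<n l)

  -- The minimal coordinate has gap 0, so its slot is free to record a further value h.
  diagonalCode : Fin n → Fin (suc j) → Fin n
  diagonalCode h = updateAt gapFin minIndex (const h)

  toℕ-diagonalCode : ∀ h {l} → l ≢ minIndex → toℕ (diagonalCode h l) ≡ gap l
  toℕ-diagonalCode h {l} l≢ι = trans (cong toℕ (updateAt-minimal l minIndex gapFin l≢ι)) (toℕ-fromℕ< _)

diagonalCode-injective : ∀ {n j h h′} {β β′ : Vec (Fin n) (suc j)} →
  minIndex β ≡ minIndex β′ → diagonalCode β h ≗ diagonalCode β′ h′ →
  h ≡ h′ × (∀ l → gap β l ≡ gap β′ l)
diagonalCode-injective {h = h} {h′} {β} {β′} ι≡ι′ codes≗ = h≡h′ , gaps≡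
  where
  open ≡-Reasoning
  ι = minIndex β
  h≡h′ : h ≡ h′
  h≡h′ = begin
    h                                 ≡⟨ updateAt-updates ι {const h} (gapFin β) ⟨
    diagonalCode β h ι                ≡⟨ codes≗ ι ⟩
    diagonalCode β′ h′ ι              ≡⟨ cong (diagonalCode β′ h′) ι≡ι′ ⟩
    diagonalCode β′ h′ (minIndex β′)  ≡⟨ updateAt-updates (minIndex β′) {const h′} (gapFin β′) ⟩
    h′                                ∎
  gaps≡ : ∀ l → gap β l ≡ gap β′ l
  gaps≡ l with l ≟ ι
  ... | yes refl = begin
    gap β ι                ≡⟨ gap-minIndex β ⟩
    0                      ≡⟨ gap-minIndex β′ ⟨
    gap β′ (minIndex β′)   ≡⟨ cong (gap β′) ι≡ι′ ⟨
    gap β′ ι               ∎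
  ... | no l≢ι = begin
    gap β l                         ≡⟨ toℕ-diagonalCode β h l≢ι ⟨
    toℕ (diagonalCode β h l)        ≡⟨ cong toℕ (codes≗ l) ⟩
    toℕ (diagonalCode β′ h′ l)      ≡⟨ toℕ-diagonalCode β′ h′ (λ l≡ι′ → l≢ι (trans l≡ι′ (sym ι≡ι′))) ⟩
    gap β′ l                        ∎

gaps-equal⇒comparable : ∀ {n j} (β β′ : Vec (Fin n) (suc j)) → (∀ l → gap β l ≡ gap β′ l) →
                        β ≡ β′ ⊎ β ≺ β′ ⊎ β′ ≺ β
gaps-equal⇒comparable β β′ gaps≡ with <-cmp (toℕ (lookup β (minIndex β))) (toℕ (lookup β′ (minIndex β′)))
... | tri< μ<μ′ _ _ = inj₂ (inj₁ (extensional⇒inductive (ext λ l →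
  m∸o≡n∸p∧o<p⇒m<n (minIndex-minimal β l) (minIndex-minimal β′ l) (gaps≡ l) μ<μ′)))
... | tri> _ _ μ′<μ = inj₂ (inj₂ (extensional⇒inductive (ext λ l →
  m∸o≡n∸p∧o<p⇒m<n (minIndex-minimal β′ l) (minIndex-minimal β l) (sym (gaps≡ l)) μ′<μ)))
... | tri≈ _ μ≡μ′ _ = inj₁ (lookup-injective λ l → toℕ-injective (∸-cancelʳ-≡
  (minIndex-minimal β l)
  (subst (_≤ _) (sym μ≡μ′) (minIndex-minimal β′ l))
  (trans (gaps≡ l) (cong (toℕ (lookup β′ l) ∸_) (sym μ≡μ′)))))

Code : ℕ → ℕ → Set
Code m n = Fin 3 × Fin m × (Fin m → Fin n)

_≈ᶜ_ : ∀ {m n} → Code m n → Code m n → Set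
(t , i , g) ≈ᶜ (t′ , i′ , g′) = t ≡ t′ × i ≡ i′ × g ≗ g′

encode : ∀ {m n} → Code m n → Fin (3 * m * n ^ m)
encode (t , i , g) = combine (combine t i) (funToFin g)

encode-injective : ∀ {m n} {c c′ : Code m n} → encode c ≡ encode c′ → c ≈ᶜ c′
encode-injective {c = t , i , g} {t′ , i′ , g′} eq = t≡t′ , i≡i′ , g≗g′
  where
  ti≡ti′ = proj₁ (combine-injective (combine t i) (funToFin g) (combine t′ i′) (funToFin g′) eq)
  g≡g′   = proj₂ (combine-injective (combine t i) (funToFin g) (combine t′ i′) (funToFin g′) eq)
  t≡t′   = proj₁ (combine-injective t i t′ i′ ti≡ti′)
  i≡i′   = proj₂ (combine-injective t i t′ i′ ti≡ti′)
  g≗g′ : g ≗ g′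
  g≗g′ l = begin
    g l                       ≡⟨ finToFun-funToFin g l ⟨
    finToFun (funToFin g) l   ≡⟨ cong (λ c → finToFun c l) g≡g′ ⟩
    finToFun (funToFin g′) l  ≡⟨ finToFun-funToFin g′ l ⟩
    g′ l                      ∎
    where open ≡-Reasoning

f-spec : ∀ {n k} (A : Perm n k) (α : Vec (Fin n) k) → arr A (insertAt α (fromℕ k) (f A α)) ≡ true
f-spec {k = k} A α = proj₁ (proj₂ (isPerm A (fromℕ k) α))

f-injective-in-head : ∀ {n m} (A : Perm n (suc m)) {h h′ : Fin n} (β : Vec (Fin n) m) →
                      f A (h ∷ β) ≡ f A (h′ ∷ β) → h ≡ h′
f-injective-in-head {n} {m} A {h} {h′} β f≡ = trans (on-line h hit) (sym (on-line h′ hit′))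
  where
  column : Fin n → Vec (Fin n) (suc m)
  column t = insertAt β (fromℕ m) t
  on-line = proj₂ (proj₂ (isPerm A 0F (column (f A (h ∷ β)))))
  hit : arr A (h ∷ column (f A (h ∷ β))) ≡ true
  hit = f-spec A (h ∷ β)
  hit′ : arr A (h′ ∷ column (f A (h ∷ β))) ≡ true
  hit′ = subst (λ t → arr A (h′ ∷ column t) ≡ true) (sym f≡) (f-spec A (h′ ∷ β))

module _ {n k : ℕ} {S : List (Vec (Fin n) (suc k))} (S-unique : Unique S) where

  _◁_ : Vec (Fin n) (suc k) → Vec (Fin n) (suc k) → Set
  y ◁ x = tail y ≡ tail x × head y <ᶠ head x

  _◁?_ : ∀ y x → Dec (y ◁ x)
  y ◁? x = ≡-dec _≟_ (tail y) (tail x) ×-dec (head y <? head x)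

  rank : Vec (Fin n) (suc k) → ℕ
  rank x = length (filter (_◁? x) S)

  rank-< : ∀ {x x′} → x ∈ S → x ◁ x′ → rank x < rank x′
  rank-< {x} {x′} x∈S (t≡t′ , h<h′) =
    Unique⇒length≤ (x∉below ∷ filter⁺ (_◁? x) S-unique) below⊆below′
    where
    x∉below : All (x ≢_) (filter (_◁? x) S)
    x∉below = All.tabulate λ y∈ → λ { refl → <ᶠ-irrefl refl (proj₂ (proj₂ (∈-filter⁻ (_◁? x) {xs = S} y∈))) }
    below⊆below′ : x ∷ filter (_◁? x) S ⊆ filter (_◁? x′) S
    below⊆below′ (here refl) = ∈-filter⁺ (_◁? x′) x∈S (t≡t′ , h<h′)
    below⊆below′ (there y∈) with ∈-filter⁻ (_◁? x) {xs = S} y∈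
    ... | y∈S , ty≡t , hy<h = ∈-filter⁺ (_◁? x′) y∈S (trans ty≡t t≡t′ , <ᶠ-trans hy<h h<h′)

  rank-injective-on-line : ∀ {h h′ β} → (h ∷ β) ∈ S → (h′ ∷ β) ∈ S →
                           rank (h ∷ β) ≡ rank (h′ ∷ β) → h ≡ h′
  rank-injective-on-line {h} {h′} x∈S x′∈S r≡r′ with <ᶠ-cmp h h′
  ... | tri< h<h′ _ _ = contradiction (rank-< {x′ = h′ ∷ _} x∈S (refl , h<h′)) (<-irrefl r≡r′)
  ... | tri≈ _ h≡h′ _ = h≡h′
  ... | tri> _ _ h′<h = contradiction (rank-< {x′ = h ∷ _} x′∈S (refl , h′<h)) (<-irrefl (sym r≡r′))

  rank≤1-below-dominated : ∀ (A : Perm n (suc k)) →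
    (∀ a b → a ∈ S → b ∈ S → a ≺ b → f A a ≡ f A b) →
    ∀ {h β β′} → (h ∷ β′) ∈ S → β ≺ β′ → rank (h ∷ β) ≤ 1
  rank≤1-below-dominated A f-const {h} {β} {β′} x′∈S β≺β′ =
    Unique∧allEqual⇒length≤1 (filter⁺ (_◁? (h ∷ β)) S-unique) all-equal
    where
    below = filter (_◁? (h ∷ β)) S
    f-below : ∀ {y} → y ∈ below → f A y ≡ f A (h ∷ β′)
    f-below {_ ∷ _} y∈ with ∈-filter⁻ (_◁? (h ∷ β)) {xs = S} y∈
    ... | y∈S , refl , hy<h = f-const _ _ y∈S x′∈S (hy<h ∷ β≺β′)
    all-equal : ∀ {y z} → y ∈ below → z ∈ below → y ≡ z
    all-equal {_ ∷ _} {_ ∷ _} y∈ z∈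
      with ∈-filter⁻ (_◁? (h ∷ β)) {xs = S} y∈ | ∈-filter⁻ (_◁? (h ∷ β)) {xs = S} z∈
    ... | _ , refl , _ | _ , refl , _ =
      cong (_∷ β) (f-injective-in-head A β (trans (f-below y∈) (sym (f-below z∈))))

module _ {n m : ℕ} (A : Perm n (suc (suc m))) {S : List (Vec (Fin n) (suc (suc m)))}
         (S-unique : Unique S)
         (f-const : ∀ a b → a ∈ S → b ∈ S → a ≺ b → f A a ≡ f A b) where

  code′ : ℕ → Vec (Fin n) (suc (suc m)) → Code (suc m) n
  code′ zero          x = 0F , 0F , lookup (tail x)
  code′ (suc zero)    x = 1F , 0F , lookup (tail x)
  code′ (suc (suc _)) x = 2F , minIndex (tail x) , diagonalCode (tail x) (head x)

  code′-injective : ∀ c c′ {x x′} → rank S-unique x ≡ c → rank S-unique x′ ≡ c′ → x ∈ S → x′ ∈ S →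
                    code′ c x ≈ᶜ code′ c′ x′ → x ≡ x′
  code′-injective zero zero {_ ∷ β} {_ ∷ β′} r r′ x∈S x′∈S (_ , _ , β≗β′)
    with refl ← lookup-injective {xs = β} {β′} β≗β′ =
    cong (_∷ β) (rank-injective-on-line S-unique x∈S x′∈S (trans r (sym r′)))
  code′-injective 1 1 {_ ∷ β} {_ ∷ β′} r r′ x∈S x′∈S (_ , _ , β≗β′)
    with refl ← lookup-injective {xs = β} {β′} β≗β′ =
    cong (_∷ β) (rank-injective-on-line S-unique x∈S x′∈S (trans r (sym r′)))
  code′-injective (suc (suc _)) (suc (suc _)) {_ ∷ β} {_ ∷ β′} r r′ x∈S x′∈S (_ , ι≡ι′ , codes≗)
    with refl , gaps≡ ← diagonalCode-injective ι≡ι′ codes≗ | gaps-equal⇒comparable β β′ gaps≡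
  ... | inj₁ refl        = refl
  ... | inj₂ (inj₁ β≺β′) =
    contradiction (subst (_≤ 1) r (rank≤1-below-dominated S-unique A f-const x′∈S β≺β′)) λ { (s≤s ()) }
  ... | inj₂ (inj₂ β′≺β) =
    contradiction (subst (_≤ 1) r′ (rank≤1-below-dominated S-unique A f-const x∈S β′≺β)) λ { (s≤s ()) }
  code′-injective 0             1             _ _ _ _ (() , _)
  code′-injective 0             (suc (suc _)) _ _ _ _ (() , _)
  code′-injective 1             0             _ _ _ _ (() , _)
  code′-injective 1             (suc (suc _)) _ _ _ _ (() , _)
  code′-injective (suc (suc _)) 0             _ _ _ _ (() , _)
  code′-injective (suc (suc _)) 1             _ _ _ _ (() , _)

  code : Vec (Fin n) (suc (suc m)) → Fin (3 * suc m * n ^ suc m)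
  code x = encode (code′ (rank S-unique x) x)

  code-injective-on-S : ∀ {x x′} → x ∈ S → x′ ∈ S → code x ≡ code x′ → x ≡ x′
  code-injective-on-S x∈S x′∈S eq = code′-injective _ _ refl refl x∈S x′∈S (encode-injective eq)

  length≤ : length S ≤ 3 * suc m * n ^ suc m
  length≤ = begin
    length S             ≡⟨ length-map code S ⟨
    length (map code S)  ≤⟨ Unique⇒length≤ (Unique-map⁺ code-injective-on-S S-unique) (λ _ → ∈-allFin _) ⟩
    length (allFin N)    ≡⟨ length-tabulate id ⟩
    N                    ∎
    where
    open ≤-Reasoning
    N = 3 * suc m * n ^ suc m

lemma9 : (k n : ℕ) → 2 ≤ k → (A : Perm n k) →
         (S : List (Vec (Fin n) k)) → Unique S →
         ((a b : Vec (Fin n) k) → a ∈ S → b ∈ S → a ≺ b → f A a ≡ f A b) →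
         length S ≤ 3 * (k ∸ 1) * n ^ (k ∸ 1)
lemma9 (suc (suc m)) n (s≤s (s≤s z≤n)) A S S-unique f-const = length≤ A S-unique f-const
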